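{- Let $n\ge3$, $A\in\mathcal{PC}_n^0$, $\tau\in\Gamma(A)$, $w\in\mathbb{R}^n_+$ and $W=[w_i/w_j]$. Then $w\in\mathcal{E}_\tau(A)$ if and only if \[ P_{A,\tau}\le W\le P_{A,\tau}^{(-T)} \] (entry-wise inequalities).
   Context: Let $N=\{1,\dots,n\}$. A matrix $A=[a_{ij}]$ is reciprocal if its entries are positive and $a_{ji}=1/a_{ij}$; $\mathcal{PC}_n$ is the set of $n\times n$ reciprocal matrices; $A$ is consistent if $a_{ij}a_{jk}=a_{ik}$ for all $i,j,k$; $\mathcal{PC}_n^0$ is the set of non-consistent matrices in $\mathcal{PC}_n$. $\mathbb{R}^n_+$ is the set of positive vectors. For a positive matrix $X$, $X^{(-T)}$ is the entry-wise inverse of its transpose. A Hamiltonian cycle (H-cycle) in $N$ is a cyclic sequence $\tau=\tau_1\cdots\tau_n\tau_1$ with $\tau_1\cdots\tau_n$ a permutation of $N$ (listable from any index). $\tau(A)=a_{\tau_1\tau_2}\cdots a_{\tau_{n-1}\tau_n}a_{\tau_n\tau_1}$; $\Gamma(A)$ is the set of H-cycles with $\tau(A)<1$. For $i\ne j$, listing $\tau$ with $\tau_1=i$ and $\tau_k=j$, $P_{A,\tau}(i,j)=a_{\tau_1\tau_2}\cdots a_{\tau_{k-1}\tau_k}$; the path matrix $P_{A,\tau}$ has diagonal entries $1$ and $(i,j)$ entry $P_{A,\tau}(i,j)$. For $\tau\in\Gamma(A)$, listed as $\tau_1\cdots\tau_n\tau_1$, $\mathcal{E}_\tau(A)=\{w\in\mathbb{R}^n_+: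 w_{\tau_1}\ge P_{A,\tau}(\tau_1,\tau_2)w_{\tau_2}\ge\cdots\ge P_{A,\tau}(\tau_1,\tau_n)w_{\tau_n}\ge \tau(A)w_{\tau_1}\}$. -}

module Defs where

open import Level using (Level; suc; _⊔_)
open import Data.Nat as ℕ using (ℕ; NonZero; _∸_)
open import Data.Nat.DivMod using (_mod_; _%_)
open import Data.Fin using (Fin; toℕ)
open import Data.Fin.Permutation using (Permutation′; _⟨$⟩ʳ_; _⟨$⟩ˡ_)
open import Data.Product using (_×_)
open import Relation.Binary.PropositionalEquality using (_≡_; _≢_)
open import Relation.Binary.Structures using (IsTotalOrder)
open import Algebra.Structures using (IsCommutativeRing)
open import Relation.Nullary using (¬_)

-- An ordered field (with propositional equality).  The real numbers are an
-- instance; stdlib has no reals, so the theorem is stated for an arbitrary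
-- ordered field.
record OrderedField (c ℓ : Level) : Set (suc (c ⊔ ℓ)) where
  infixl 7 _*_
  infixl 6 _+_
  infix 4 _≤_ _<_
  field
    Carrier : Set c
    _+_ _*_ : Carrier → Carrier → Carrier
    -_ : Carrier → Carrier
    0# 1# : Carrier
    _⁻¹ : Carrier → Carrier          -- total; value at 0 is irrelevant
    _≤_ : Carrier → Carrier → Set ℓ
    isCommutativeRing : IsCommutativeRing _≡_ _+_ _*_ -_ 0# 1#
    isTotalOrder : IsTotalOrder _≡_ _≤_
    0≢1 : 0# ≢ 1#
    *-inverse : ∀ x → x ≢ 0# → x * (x ⁻¹) ≡ 1#
    +-mono-≤ : ∀ {x y} z → x ≤ y → x + z ≤ y + z
    *-nonneg : ∀ {x y} → 0# ≤ x → 0# ≤ y → 0# ≤ x * y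

  _<_ : Carrier → Carrier → Set (c ⊔ ℓ)
  x < y = x ≤ y × x ≢ y

module _ {c ℓ} (F : OrderedField c ℓ) where
  open OrderedField F

  Matrix : ℕ → Set c
  Matrix n = Fin n → Fin n → Carrier

  Positive : ∀ {n} → (Fin n → Carrier) → Set (c ⊔ ℓ)
  Positive {n} w = ∀ i → 0# < w i

  Reciprocal : ∀ {n} → Matrix n → Set (c ⊔ ℓ)
  Reciprocal A = (∀ i j → 0# < A i j) × (∀ i j → A j i ≡ (A i j) ⁻¹)

  Consistent : ∀ {n} → Matrix n → Set c
  Consistent A = ∀ i j k → A i j * A j k ≡ A i k

  NonConsistentReciprocal : ∀ {n} → Matrix n → Set (c ⊔ ℓ)
  NonConsistentReciprocal A = Reciprocal A × ¬ Consistent A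

  -- An H-cycle τ = τ_0 τ_1 ... τ_{n-1} τ_0 is given by a listing, i.e. a
  -- permutation σ with τ_k = σ(k mod n) (0-based indices).
  module _ {n : ℕ} .{{_ : NonZero n}} (A : Matrix n) (σ : Permutation′ n) where

    τ : ℕ → Fin n
    τ k = σ ⟨$⟩ʳ (k mod n)

    pathFrom : ℕ → ℕ → Carrier
    pathFrom p ℕ.zero = 1#
    pathFrom p (ℕ.suc d) = A (τ p) (τ (ℕ.suc p)) * pathFrom (ℕ.suc p) d

    cycleValue : Carrier
    cycleValue = pathFrom 0 n

    pos : Fin n → ℕ
    pos i = toℕ (σ ⟨$⟩ˡ i)

    -- path matrix P_{A,τ}: product along τ from i forward to j
    -- (diagonal: empty product = 1)
    PathMatrix : Matrix n
    PathMatrix i j = pathFrom (pos i) (((pos j ℕ.+ n) ∸ pos i) % n)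

    -- w ∈ E_τ(A)  (for τ ∈ Γ(A)), with the listing τ_0 … τ_{n-1}:
    -- w_{τ_0} ≥ P(τ_0,τ_1) w_{τ_1} ≥ ⋯ ≥ P(τ_0,τ_{n-1}) w_{τ_{n-1}} ≥ τ(A) w_{τ_0}
    InE : (Fin n → Carrier) → Set (c ⊔ ℓ)
    InE w = Positive w
          × (∀ k → ℕ.suc k ℕ.< n →
               PathMatrix (τ 0) (τ (ℕ.suc k)) * w (τ (ℕ.suc k))
                 ≤ PathMatrix (τ 0) (τ k) * w (τ k))
          × (cycleValue * w (τ 0) ≤ PathMatrix (τ 0) (τ (n ∸ 1)) * w (τ (n ∸ 1)))

  ratioMatrix : ∀ {n} → (Fin n → Carrier) → Matrix n
  ratioMatrix w i j = w i * (w j) ⁻¹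

  invTranspose : ∀ {n} → Matrix n → Matrix n
  invTranspose X i j = (X j i) ⁻¹

  _≤ₘ_ : ∀ {n} → Matrix n → Matrix n → Set ℓ
  X ≤ₘ Y = ∀ i j → X i j ≤ Y i j

module Submission where

-- Write v_k = P(τ_0, τ_k) w_{τ_k}, the k-th quantity in the chain defining E_τ(A).  Along the
-- cycle the path products factor through prefixes: for a ≤ b, P(τ_0,τ_a) P(τ_a,τ_b) = P(τ_0,τ_b),
-- and for b < a the path from τ_a to τ_b runs once round the cycle, so
-- P(τ_0,τ_a) P(τ_a,τ_b) = τ(A) P(τ_0,τ_b).  Hence P(τ_a,τ_b) w_{τ_b} ≤ w_{τ_a} says v_b ≤ v_a when
-- a ≤ b, and τ(A) v_b ≤ v_a when b < a.  The chain defining E_τ(A) consists of exactly the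
-- adjacent instances of these inequalities, and they imply all others by transitivity.  Finally
-- P ≤ W is the inequality P_ij w_j ≤ w_i, and so is W ≤ P^(-T) after exchanging i and j.

open import Defs
import Data.Nat as ℕ
open import Data.Nat using (ℕ; NonZero; suc; zero; z≤n; _≤′_; ≤′-reflexive; ≤′-step)
open import Data.Nat.Properties as ℕₚ using ()
open import Data.Nat.DivMod using (_%_; _mod_; m<n⇒m%n≡m; [m+n]%n≡m%n)
open import Data.Fin using (Fin; toℕ)
open import Data.Fin.Properties using (toℕ-fromℕ<; fromℕ<-toℕ; fromℕ<-cong; toℕ<n)
open import Data.Fin.Permutation using (Permutation′; _⟨$⟩ʳ_; _⟨$⟩ˡ_; inverseʳ; inverseˡ)
open import Data.Product using (_×_; _,_; proj₁)
open import Data.Sum using (inj₁; inj₂)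
open import Data.Empty using (⊥-elim)
open import Relation.Nullary using (yes; no)
open import Relation.Binary.PropositionalEquality
open import Relation.Binary.Structures using (IsTotalOrder)
open import Algebra.Structures using (IsCommutativeRing)
open import Algebra.Bundles using (CommutativeRing)
open import Function.Bundles using (_⇔_; mk⇔; Equivalence)
open import Function.Properties.Equivalence using () renaming (trans to ⇔-trans; sym to ⇔-sym)

module OrderedFieldProperties {c ℓ} (F : OrderedField c ℓ) where
  open OrderedField F
  open IsCommutativeRing isCommutativeRing
    using (+-identityˡ; -‿inverseˡ; -‿inverseʳ; *-assoc; *-comm; *-identityˡ; *-identityʳ; zeroʳ)
  open IsTotalOrder isTotalOrder using (total; antisym)
    renaming (refl to ≤-refl; trans to ≤-trans)

  commutativeRing : CommutativeRing c c
  commutativeRing = record { isCommutativeRing = isCommutativeRing }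

  open import Algebra.Properties.Ring (CommutativeRing.ring commutativeRing)
    using (-‿distribʳ-*; -1*x≈-x; -‿involutive; [y-z]x≈yx-zx; //-rightDividesˡ)
  open ≡-Reasoning

  x≤0⇒0≤-x : ∀ {x} → x ≤ 0# → 0# ≤ - x
  x≤0⇒0≤-x {x} h = subst₂ _≤_ (-‿inverseʳ x) (+-identityˡ (- x)) (+-mono-≤ (- x) h)

  0≤-x⇒x≤0 : ∀ {x} → 0# ≤ - x → x ≤ 0#
  0≤-x⇒x≤0 {x} h = subst₂ _≤_ (+-identityˡ x) (-‿inverseˡ x) (+-mono-≤ x h)

  *-monoˡ-≤-nonneg : ∀ {x y z} → 0# ≤ z → x ≤ y → x * z ≤ y * z
  *-monoˡ-≤-nonneg {x} {y} {z} 0≤z x≤y =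
    subst₂ _≤_ (+-identityˡ (x * z)) cancel (+-mono-≤ (x * z) 0≤[y-x]z)
    where
    0≤[y-x]z : 0# ≤ (y + - x) * z
    0≤[y-x]z = *-nonneg (subst₂ _≤_ (-‿inverseʳ x) refl (+-mono-≤ (- x) x≤y)) 0≤z
    cancel : (y + - x) * z + x * z ≡ y * z
    cancel = trans (cong (_+ x * z) ([y-z]x≈yx-zx z y x)) (//-rightDividesˡ (x * z) (y * z))

  *-monoʳ-≤-nonneg : ∀ {x y z} → 0# ≤ z → x ≤ y → z * x ≤ z * y
  *-monoʳ-≤-nonneg {x} {y} {z} 0≤z x≤y =
    subst₂ _≤_ (*-comm x z) (*-comm y z) (*-monoˡ-≤-nonneg 0≤z x≤y)

  -- In a total order either 0 ≤ 1, or 1 ≤ 0 and then 0 ≤ (-1)(-1) = 1.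
  0≤1 : 0# ≤ 1#
  0≤1 with total 0# 1#
  ... | inj₁ 0≤1 = 0≤1
  ... | inj₂ 1≤0 = subst (0# ≤_) [-1][-1]≡1 (*-nonneg (x≤0⇒0≤-x 1≤0) (x≤0⇒0≤-x 1≤0))
    where
    [-1][-1]≡1 : - 1# * - 1# ≡ 1#
    [-1][-1]≡1 = trans (-1*x≈-x (- 1#)) (-‿involutive 1#)

  *-inverseˡ : ∀ {z} → 0# < z → z ⁻¹ * z ≡ 1#
  *-inverseˡ {z} (_ , 0≢z) = trans (*-comm (z ⁻¹) z) (*-inverse z (λ z≡0 → 0≢z (sym z≡0)))

  ⁻¹-pos : ∀ {z} → 0# < z → 0# < z ⁻¹
  ⁻¹-pos {z} 0<z@(0≤z , _) = 0≤z⁻¹ , 0≢z⁻¹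
    where
    0≢z⁻¹ : 0# ≢ z ⁻¹
    0≢z⁻¹ 0≡z⁻¹ = 0≢1 (begin
      0#         ≡⟨ sym (zeroʳ z) ⟩
      z * 0#     ≡⟨ cong (z *_) 0≡z⁻¹ ⟩
      z * z ⁻¹   ≡⟨ trans (*-comm z (z ⁻¹)) (*-inverseˡ 0<z) ⟩
      1#         ∎)
    -- If z⁻¹ ≤ 0 then 0 ≤ z (-z⁻¹) = -1, i.e. 1 ≤ 0.
    0≤z⁻¹ : 0# ≤ z ⁻¹
    0≤z⁻¹ with total 0# (z ⁻¹)
    ... | inj₁ 0≤z⁻¹ = 0≤z⁻¹
    ... | inj₂ z⁻¹≤0 = ⊥-elim (0≢1 (antisym 0≤1 (0≤-x⇒x≤0 0≤-1)))
      where
      0≤-1 : 0# ≤ - 1#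
      0≤-1 = subst (0# ≤_)
        (trans (sym (-‿distribʳ-* z (z ⁻¹))) (cong -_ (trans (*-comm z (z ⁻¹)) (*-inverseˡ 0<z))))
        (*-nonneg 0≤z (x≤0⇒0≤-x z⁻¹≤0))

  *-pos : ∀ {x y} → 0# < x → 0# < y → 0# < x * y
  *-pos {x} {y} 0<x@(0≤x , _) (0≤y , 0≢y) = *-nonneg 0≤x 0≤y , 0≢xy
    where
    0≢xy : 0# ≢ x * y
    0≢xy 0≡xy = 0≢y (begin
      0#               ≡⟨ sym (zeroʳ (x ⁻¹)) ⟩
      x ⁻¹ * 0#        ≡⟨ cong (x ⁻¹ *_) 0≡xy ⟩
      x ⁻¹ * (x * y)   ≡⟨ sym (*-assoc (x ⁻¹) x y) ⟩
      x ⁻¹ * x * y     ≡⟨ cong (_* y) (*-inverseˡ 0<x) ⟩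
      1# * y           ≡⟨ *-identityˡ y ⟩
      y                ∎)

  *-⁻¹-cancelʳ : ∀ {x z} → 0# < z → x * z * z ⁻¹ ≡ x
  *-⁻¹-cancelʳ {x} {z} 0<z = begin
    x * z * z ⁻¹     ≡⟨ *-assoc x z (z ⁻¹) ⟩
    x * (z * z ⁻¹)   ≡⟨ cong (x *_) (trans (*-comm z (z ⁻¹)) (*-inverseˡ 0<z)) ⟩
    x * 1#           ≡⟨ *-identityʳ x ⟩
    x                ∎

  ⁻¹-*-cancelʳ : ∀ {x z} → 0# < z → x * z ⁻¹ * z ≡ x
  ⁻¹-*-cancelʳ {x} {z} 0<z =
    trans (*-assoc x (z ⁻¹) z) (trans (cong (x *_) (*-inverseˡ 0<z)) (*-identityʳ x))

  *-scaleʳ-≤⇔ : ∀ {x y z} → 0# < z → x ≤ y ⇔ x * z ≤ y * z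
  *-scaleʳ-≤⇔ {z = z} 0<z = mk⇔ (*-monoˡ-≤-nonneg (proj₁ 0<z))
    (λ xz≤yz → subst₂ _≤_ (*-⁻¹-cancelʳ 0<z) (*-⁻¹-cancelʳ 0<z)
                 (*-monoˡ-≤-nonneg (proj₁ (⁻¹-pos 0<z)) xz≤yz))

  *-scaleˡ-≤⇔ : ∀ {x y z} → 0# < z → x ≤ y ⇔ z * x ≤ z * y
  *-scaleˡ-≤⇔ {x} {y} {z} 0<z =
    subst₂ (λ zx zy → x ≤ y ⇔ zx ≤ zy) (*-comm x z) (*-comm y z) (*-scaleʳ-≤⇔ 0<z)

  ≤-/⇔ : ∀ {x y z} → 0# < z → x ≤ y * z ⁻¹ ⇔ x * z ≤ y
  ≤-/⇔ {x} {y} {z} 0<z = subst (λ t → x ≤ y * z ⁻¹ ⇔ x * z ≤ t) (⁻¹-*-cancelʳ 0<z) (*-scaleʳ-≤⇔ 0<z)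

  /-≤⇔ : ∀ {x y z} → 0# < z → x * z ⁻¹ ≤ y ⇔ x ≤ y * z
  /-≤⇔ {x} {y} {z} 0<z = subst (λ t → x * z ⁻¹ ≤ y ⇔ t ≤ y * z) (⁻¹-*-cancelʳ 0<z) (*-scaleʳ-≤⇔ 0<z)

  /-≤-⁻¹⇔ : ∀ {q y z} → 0# < q → 0# < z → y * z ⁻¹ ≤ q ⁻¹ ⇔ q * y ≤ z
  /-≤-⁻¹⇔ {q} {y} {z} 0<q 0<z = ⇔-trans (/-≤⇔ 0<z)
    (subst₂ (λ s t → y ≤ s ⇔ t ≤ z) (*-comm z (q ⁻¹)) (*-comm y q) (≤-/⇔ 0<q))

  ≤-stepwise-antitone : ∀ {n} (v : ℕ → Carrier) → (∀ k → suc k ℕ.< n → v (suc k) ≤ v k) →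
                        ∀ {a b} → a ℕ.≤ b → b ℕ.< n → v b ≤ v a
  ≤-stepwise-antitone v step a≤b = go (ℕₚ.≤⇒≤′ a≤b)
    where
    go : ∀ {a b} → a ≤′ b → b ℕ.< _ → v b ≤ v a
    go (≤′-reflexive refl) _ = ≤-refl
    go (≤′-step {b} a≤′b) 1+b<n = ≤-trans (step b 1+b<n) (go a≤′b (ℕₚ.<-trans (ℕₚ.n<1+n b) 1+b<n))

  module _ {n : ℕ} where

    RatioBounded : Matrix F n → (Fin n → Carrier) → Set ℓ
    RatioBounded X w = ∀ i j → X i j * w j ≤ w i

    ratioBounded⇔between : ∀ {X w} → (∀ i j → 0# < X i j) → Positive F w →
      RatioBounded X w ⇔ (_≤ₘ_ F X (ratioMatrix F w) × _≤ₘ_ F (ratioMatrix F w) (invTranspose F X))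
    ratioBounded⇔between X>0 w>0 = mk⇔
      (λ bounded → (λ i j → Equivalence.from (≤-/⇔ (w>0 j)) (bounded i j))
                 , (λ i j → Equivalence.from (/-≤-⁻¹⇔ (X>0 j i) (w>0 j)) (bounded j i)))
      (λ (X≤W , _) i j → Equivalence.to (≤-/⇔ (w>0 j)) (X≤W i j))

open import Data.Nat using (_+_; _∸_)

module _ {n : ℕ} .{{_ : NonZero n}} where

  n∸1<n : n ∸ 1 ℕ.< n
  n∸1<n = ℕₚ.<-≤-trans (ℕₚ.n<1+n _) (ℕₚ.≤-reflexive (ℕₚ.suc-pred n))

  toℕ-mod : ∀ {a} → a ℕ.< n → toℕ (a mod n) ≡ a
  toℕ-mod a<n = trans (toℕ-fromℕ< _) (m<n⇒m%n≡m a<n)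

  mod-toℕ : ∀ i → toℕ i mod n ≡ i
  mod-toℕ i = trans (fromℕ<-cong _ _ (m<n⇒m%n≡m (toℕ<n i)) _ (toℕ<n i)) (fromℕ<-toℕ i _)

  mod-periodic : ∀ a → (a + n) mod n ≡ a mod n
  mod-periodic a = fromℕ<-cong _ _ ([m+n]%n≡m%n a n) _ _

  forward-offset : ∀ {a b} → a ℕ.≤ b → b ℕ.< n → (b + n ∸ a) % n ≡ b ∸ a
  forward-offset {a} {b} a≤b b<n = begin
    (b + n ∸ a) % n   ≡⟨ cong (_% n) (ℕₚ.+-∸-comm n a≤b) ⟩
    (b ∸ a + n) % n   ≡⟨ [m+n]%n≡m%n (b ∸ a) n ⟩
    (b ∸ a) % n       ≡⟨ m<n⇒m%n≡m (ℕₚ.≤-<-trans (ℕₚ.m∸n≤m b a) b<n) ⟩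
    b ∸ a             ∎
    where open ≡-Reasoning

  backward-offset : ∀ {a b} → b ℕ.< a → a ℕ.< n → (b + n ∸ a) % n ≡ (n ∸ a) + b
  backward-offset {a} {b} b<a a<n = begin
    (b + n ∸ a) % n    ≡⟨ cong (_% n) (ℕₚ.+-∸-assoc b a≤n) ⟩
    (b + (n ∸ a)) % n  ≡⟨ cong (_% n) (ℕₚ.+-comm b (n ∸ a)) ⟩
    (n ∸ a + b) % n    ≡⟨ m<n⇒m%n≡m n∸a+b<n ⟩
    n ∸ a + b          ∎
    where
    open ≡-Reasoning
    a≤n : a ℕ.≤ n
    a≤n = ℕₚ.<⇒≤ a<n
    n∸a+b<n : n ∸ a + b ℕ.< n
    n∸a+b<n = subst (n ∸ a + b ℕ.<_) (ℕₚ.m∸n+n≡m a≤n) (ℕₚ.+-monoʳ-< (n ∸ a) b<a)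

module CyclicPaths {c ℓ} (F : OrderedField c ℓ) {n : ℕ} .{{_ : NonZero n}}
                   (A : Matrix F n) (σ : Permutation′ n) where
  open OrderedField F using (Carrier; _*_; 0#; _<_; 0≢1; isCommutativeRing)
  open IsCommutativeRing isCommutativeRing using (*-assoc; *-identityˡ)
  open OrderedFieldProperties F using (*-pos; 0≤1)
  open ≡-Reasoning

  private
    τ′ : ℕ → Fin n
    τ′ = τ F A σ
    path : ℕ → ℕ → Carrier
    path = pathFrom F A σ
    P : Matrix F n
    P = PathMatrix F A σ
    C : Carrier
    C = cycleValue F A σ

  prefix : ℕ → Carrier
  prefix = path 0

  pos-τ : ∀ {a} → a ℕ.< n → pos F A σ (τ′ a) ≡ a
  pos-τ a<n = trans (cong toℕ (inverseˡ σ)) (toℕ-mod a<n)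

  τ-pos : ∀ i → τ′ (pos F A σ i) ≡ i
  τ-pos i = trans (cong (σ ⟨$⟩ʳ_) (mod-toℕ (σ ⟨$⟩ˡ i))) (inverseʳ σ)

  τ-periodic : ∀ a → τ′ (a + n) ≡ τ′ a
  τ-periodic a = cong (σ ⟨$⟩ʳ_) (mod-periodic a)

  pathFrom-periodic : ∀ p d → path (p + n) d ≡ path p d
  pathFrom-periodic p zero = refl
  pathFrom-periodic p (suc d) =
    cong₂ _*_ (cong₂ A (τ-periodic p) (τ-periodic (suc p))) (pathFrom-periodic (suc p) d)

  pathFrom-+ : ∀ p d e → path p (d + e) ≡ path p d * path (p + d) e
  pathFrom-+ p zero e = trans (cong (λ q → path q e) (sym (ℕₚ.+-identityʳ p))) (sym (*-identityˡ _))
  pathFrom-+ p (suc d) e = begin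
    a * path (suc p) (d + e)                     ≡⟨ cong (a *_) (pathFrom-+ (suc p) d e) ⟩
    a * (path (suc p) d * path (suc p + d) e)    ≡⟨ sym (*-assoc a _ _) ⟩
    a * path (suc p) d * path (suc p + d) e      ≡⟨ cong (λ q → a * path (suc p) d * path q e) (sym (ℕₚ.+-suc p d)) ⟩
    a * path (suc p) d * path (p + suc d) e      ∎
    where
    a : Carrier
    a = A (τ′ p) (τ′ (suc p))

  pathFrom-pos : (∀ i j → 0# < A i j) → ∀ p d → 0# < path p d
  pathFrom-pos A>0 p zero = 0≤1 , 0≢1
  pathFrom-pos A>0 p (suc d) = *-pos (A>0 _ _) (pathFrom-pos A>0 (suc p) d)

  PathMatrix-pos : (∀ i j → 0# < A i j) → ∀ i j → 0# < P i j
  PathMatrix-pos A>0 i j = pathFrom-pos A>0 (pos F A σ i) ((pos F A σ j + n ∸ pos F A σ i) % n)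

  prefix-* : ∀ a d → prefix a * path a d ≡ prefix (a + d)
  prefix-* a d = sym (pathFrom-+ 0 a d)

  prefix-wrap : ∀ b → prefix (n + b) ≡ C * prefix b
  prefix-wrap b = trans (pathFrom-+ 0 n b) (cong (C *_) (pathFrom-periodic 0 b))

  PathMatrix-τ : ∀ {a b} → a ℕ.< n → b ℕ.< n → P (τ′ a) (τ′ b) ≡ path a ((b + n ∸ a) % n)
  PathMatrix-τ a<n b<n = cong₂ (λ p q → path p ((q + n ∸ p) % n)) (pos-τ a<n) (pos-τ b<n)

  PathMatrix-forward : ∀ {a b} → a ℕ.≤ b → b ℕ.< n → prefix a * P (τ′ a) (τ′ b) ≡ prefix b
  PathMatrix-forward {a} {b} a≤b b<n = begin
    prefix a * P (τ′ a) (τ′ b)   ≡⟨ cong (prefix a *_) (PathMatrix-τ (ℕₚ.≤-<-trans a≤b b<n) b<n) ⟩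
    prefix a * path a ((b + n ∸ a) % n) ≡⟨ cong (λ d → prefix a * path a d) (forward-offset a≤b b<n) ⟩
    prefix a * path a (b ∸ a)    ≡⟨ prefix-* a (b ∸ a) ⟩
    prefix (a + (b ∸ a))         ≡⟨ cong prefix (ℕₚ.m+[n∸m]≡n a≤b) ⟩
    prefix b                     ∎

  PathMatrix-backward : ∀ {a b} → b ℕ.< a → a ℕ.< n → prefix a * P (τ′ a) (τ′ b) ≡ C * prefix b
  PathMatrix-backward {a} {b} b<a a<n = begin
    prefix a * P (τ′ a) (τ′ b)        ≡⟨ cong (prefix a *_) (PathMatrix-τ a<n (ℕₚ.<-trans b<a a<n)) ⟩
    prefix a * path a ((b + n ∸ a) % n) ≡⟨ cong (λ d → prefix a * path a d) (backward-offset b<a a<n) ⟩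
    prefix a * path a (n ∸ a + b)     ≡⟨ prefix-* a (n ∸ a + b) ⟩
    prefix (a + (n ∸ a + b))          ≡⟨ cong prefix a+[n∸a+b]≡n+b ⟩
    prefix (n + b)                    ≡⟨ prefix-wrap b ⟩
    C * prefix b                      ∎
    where
    a+[n∸a+b]≡n+b : a + (n ∸ a + b) ≡ n + b
    a+[n∸a+b]≡n+b = trans (sym (ℕₚ.+-assoc a (n ∸ a) b)) (cong (_+ b) (ℕₚ.m+[n∸m]≡n (ℕₚ.<⇒≤ a<n)))

  PathMatrix-from-τ₀ : ∀ {k} → k ℕ.< n → P (τ′ 0) (τ′ k) ≡ prefix k
  PathMatrix-from-τ₀ k<n = trans (sym (*-identityˡ _)) (PathMatrix-forward z≤n k<n)

module Chain {c ℓ} (F : OrderedField c ℓ) {n : ℕ} .{{_ : NonZero n}}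
             (A : Matrix F n) (A>0 : ∀ i j → OrderedField._<_ F (OrderedField.0# F) (A i j))
             (σ : Permutation′ n) (w : Fin n → OrderedField.Carrier F) where
  open OrderedField F using (Carrier; _*_; _≤_; isCommutativeRing; isTotalOrder)
  open IsCommutativeRing isCommutativeRing using (*-assoc; *-identityˡ)
  open IsTotalOrder isTotalOrder using () renaming (trans to ≤-trans)
  open OrderedFieldProperties F
  open CyclicPaths F A σ

  private
    τ′ : ℕ → Fin n
    τ′ = τ F A σ
    P : Matrix F n
    P = PathMatrix F A σ
    C : Carrier
    C = cycleValue F A σ

  scaled : ℕ → Carrier
  scaled k = prefix k * w (τ′ k)

  StepsDescend : Set ℓ
  StepsDescend = ∀ k → suc k ℕ.< n → scaled (suc k) ≤ scaled k

  CycleCloses : Set ℓ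
  CycleCloses = C * scaled 0 ≤ scaled (n ∸ 1)

  bounded-forward⇔ : ∀ {a b} → a ℕ.≤ b → b ℕ.< n →
                     P (τ′ a) (τ′ b) * w (τ′ b) ≤ w (τ′ a) ⇔ scaled b ≤ scaled a
  bounded-forward⇔ {a} {b} a≤b b<n =
    subst (λ x → P (τ′ a) (τ′ b) * w (τ′ b) ≤ w (τ′ a) ⇔ x ≤ scaled a) reassociate
      (*-scaleˡ-≤⇔ (pathFrom-pos A>0 0 a))
    where
    reassociate : prefix a * (P (τ′ a) (τ′ b) * w (τ′ b)) ≡ scaled b
    reassociate = trans (sym (*-assoc _ _ _)) (cong (_* w (τ′ b)) (PathMatrix-forward a≤b b<n))

  bounded-backward⇔ : ∀ {a b} → b ℕ.< a → a ℕ.< n →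
                      P (τ′ a) (τ′ b) * w (τ′ b) ≤ w (τ′ a) ⇔ C * scaled b ≤ scaled a
  bounded-backward⇔ {a} {b} b<a a<n =
    subst (λ x → P (τ′ a) (τ′ b) * w (τ′ b) ≤ w (τ′ a) ⇔ x ≤ scaled a) reassociate
      (*-scaleˡ-≤⇔ (pathFrom-pos A>0 0 a))
    where
    reassociate : prefix a * (P (τ′ a) (τ′ b) * w (τ′ b)) ≡ C * scaled b
    reassociate = trans (sym (*-assoc _ _ _))
      (trans (cong (_* w (τ′ b)) (PathMatrix-backward b<a a<n)) (*-assoc _ _ _))

  ratioBounded⇔chain : 1 ℕ.< n → RatioBounded P w ⇔ (StepsDescend × CycleCloses)
  ratioBounded⇔chain 1<n = mk⇔
    (λ bounded → (λ k 1+k<n → Equivalence.to (bounded-forward⇔ (ℕₚ.n≤1+n k) 1+k<n) (bounded _ _))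
               , Equivalence.to (bounded-backward⇔ 0<n∸1 n∸1<n) (bounded _ _))
    (λ (descend , close) i j → subst₂ (λ i j → P i j * w j ≤ w i) (τ-pos i) (τ-pos j)
       (bounded-at (≤-stepwise-antitone scaled descend) close (toℕ<n _) (toℕ<n _)))
    where
    0<n∸1 : 0 ℕ.< n ∸ 1
    0<n∸1 = ℕₚ.m<n⇒0<n∸m 1<n
    bounded-at : (∀ {a b} → a ℕ.≤ b → b ℕ.< n → scaled b ≤ scaled a) → CycleCloses →
                 ∀ {a b} → a ℕ.< n → b ℕ.< n → P (τ′ a) (τ′ b) * w (τ′ b) ≤ w (τ′ a)
    bounded-at descending close {a} {b} a<n b<n with a ℕ.≤? b
    ... | yes a≤b = Equivalence.from (bounded-forward⇔ a≤b b<n) (descending a≤b b<n)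
    -- C v_b ≤ C v_0 ≤ v_{n-1} ≤ v_a
    ... | no a≰b = Equivalence.from (bounded-backward⇔ (ℕₚ.≰⇒> a≰b) a<n)
      (≤-trans (*-monoʳ-≤-nonneg (proj₁ (pathFrom-pos A>0 0 n)) (descending z≤n b<n))
      (≤-trans close (descending (ℕₚ.<⇒≤pred a<n) n∸1<n)))

  inE⇔chain : Positive F w → InE F A σ w ⇔ (StepsDescend × CycleCloses)
  inE⇔chain w>0 = mk⇔
    (λ (_ , steps , last) → (λ k 1+k<n → subst₂ _≤_ (entry 1+k<n) (entry (below 1+k<n)) (steps k 1+k<n))
                          , subst₂ _≤_ (cong (C *_) (sym (*-identityˡ _))) (entry n∸1<n) last)
    (λ (descend , close) → w>0
                         , (λ k 1+k<n → subst₂ _≤_ (sym (entry 1+k<n)) (sym (entry (below 1+k<n))) (descend k 1+k<n))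
                         , subst₂ _≤_ (cong (C *_) (*-identityˡ _)) (sym (entry n∸1<n)) close)
    where
    entry : ∀ {k} → k ℕ.< n → P (τ′ 0) (τ′ k) * w (τ′ k) ≡ scaled k
    entry k<n = cong (_* w (τ′ _)) (PathMatrix-from-τ₀ k<n)
    below : ∀ {k} → suc k ℕ.< n → k ℕ.< n
    below = ℕₚ.<-trans (ℕₚ.n<1+n _)

open import Data.Nat using (_≤_)

theorem4p1 : ∀ {c ℓ} (F : OrderedField c ℓ) (n : ℕ) .{{_ : NonZero n}} → 3 ≤ n →
    (A : Matrix F n) → NonConsistentReciprocal F A →
    (σ : Permutation′ n) → OrderedField._<_ F (cycleValue F A σ) (OrderedField.1# F) →
    (w : Fin n → OrderedField.Carrier F) → Positive F w →
    InE F A σ w ⇔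
    (_≤ₘ_ F (PathMatrix F A σ) (ratioMatrix F w)
    × _≤ₘ_ F (ratioMatrix F w) (invTranspose F (PathMatrix F A σ)))
theorem4p1 F n 3≤n A ((A>0 , _) , _) σ _ w w>0 =
  ⇔-trans (inE⇔chain w>0)
  (⇔-trans (⇔-sym (ratioBounded⇔chain (ℕₚ.≤-trans (ℕₚ.n≤1+n 2) 3≤n)))
           (ratioBounded⇔between (CyclicPaths.PathMatrix-pos F A σ A>0) w>0))
  where
  open Chain F A A>0 σ w
  open OrderedFieldProperties F using (ratioBounded⇔between)
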